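{- Let $S=\langle s_0,\dots,s_{n-1}\rangle$ be a non-empty sequence of binary strings whose set $S_{\mathrm{set}}$ of distinct strings is prefix-free, and let $\tilde h$ be the average height of its Wavelet Trie $\mathrm{WT}(S)$. Then $$H_0(S)\le \tilde h\le \frac1n\sum_{i=0}^{n-1}|s_i|.$$
   Context: The Wavelet Trie $\mathrm{WT}(S)$ is defined recursively: (i) if all $s_i$ equal the same string $\alpha$, it is a single leaf labeled $\alpha$; (ii) otherwise let $\alpha$ be the longest common prefix of the $s_i$, write $s_i=\alpha b_i\gamma_i$ with $b_i\in\{0,1\}$, let $\beta=\langle b_0,\dots,b_{n-1}\rangle$ and $S_b=\langle \gamma_i : b_i=b\rangle$ for $b\in\{0,1\}$ (order preserved); $\mathrm{WT}(S)$ has an internal root labeled $\alpha$ and $\beta$ with $0$- and $1$-children $\mathrm{WT}(S_0)$, $\mathrm{WT}(S_1)$. Its leaves correspond to the elements of $S_{\mathrm{set}}$. For $s\in S_{\mathrm{set}}$, $h_s$ is the number of internal nodes on the root-to-leaf path representing $s$, and $\tilde h=\frac1n\sum_{i=0}^{n-1}h_{s_i}$. $H_0(S)=-\sum_{c\in S_{\mathrm{set}}}\frac{n_c}{n}\log_2\frac{n_c}{n}$, where $n_c$ is the number of occurrences of $c$ in $S$. $|s|$ is the length of $s$. -}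

module Defs where

open import Data.Bool using (Bool; true; false)
import Data.Bool.Properties as BoolP
open import Data.Nat using (ℕ; zero; suc; _+_; _*_; _^_)
open import Data.List using (List; []; _∷_; _++_; map; length; drop; filter; deduplicate; foldl)
open import Data.Nat.ListAction using (sum; product)
import Data.List.Properties as ListP
open import Data.List.Membership.Propositional using (_∈_)
open import Data.List.Relation.Unary.All using (all?)
open import Data.Product using (∃; _×_)
open import Relation.Nullary using (yes; no; ¬_)
open import Relation.Binary.PropositionalEquality using (_≡_)
open import Relation.Binary.Definitions using (DecidableEquality)

BitString : Set
BitString = List Bool

_≟s_ : DecidableEquality BitString
_≟s_ = ListP.≡-dec BoolP._≟_

_≼_ : BitString → BitString → Set
u ≼ v = ∃ λ w → u ++ w ≡ v

PrefixFree : List BitString → Set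
PrefixFree S = ∀ {u v} → u ∈ S → v ∈ S → u ≼ v → u ≡ v

lcp₂ : BitString → BitString → BitString
lcp₂ (true  ∷ u) (true  ∷ v) = true  ∷ lcp₂ u v
lcp₂ (false ∷ u) (false ∷ v) = false ∷ lcp₂ u v
lcp₂ _ _ = []

lcp : List BitString → BitString
lcp []       = []
lcp (x ∷ xs) = foldl lcp₂ x xs

data WTree : Set where
  leaf : BitString → WTree
  node : (α : BitString) (β : List Bool) (t₀ t₁ : WTree) → WTree

-- Given the suffixes γ' = b γ remaining after removing α:
-- the bit b_i (strings with no next bit cannot occur for prefix-free S
-- that are not all equal; they are simply skipped).
bits : List BitString → List Bool
bits []            = []
bits ([] ∷ xs)     = bits xs
bits ((b ∷ _) ∷ xs) = b ∷ bits xs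

sub : Bool → List BitString → List BitString
sub b []              = []
sub b ([] ∷ xs)       = sub b xs
sub b ((c ∷ γ) ∷ xs) with BoolP._≟_ b c
... | yes _ = γ ∷ sub b xs
... | no  _ = sub b xs

-- WT with fuel (the recursion strips ≥ 1 bit from every string per level,
-- so fuel 1 + Σ|s_i| is always sufficient).
wtF : ℕ → List BitString → WTree
wtF _ [] = leaf []
wtF zero (x ∷ xs) = leaf x
wtF (suc k) (x ∷ xs) with all? (λ s → s ≟s x) xs
... | yes _ = leaf x
... | no  _ =
  let S  = x ∷ xs
      α  = lcp S
      rs = map (drop (length α)) S
  in node α (bits rs) (wtF k (sub false rs)) (wtF k (sub true rs))

WT : List BitString → WTree
WT S = wtF (suc (sum (map length S))) S

height : WTree → BitString → ℕ
height (leaf _) s = 0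
height (node α β t₀ t₁) s with drop (length α) s
... | []          = 0
... | false ∷ γ   = suc (height t₀ γ)
... | true  ∷ γ   = suc (height t₁ γ)

-- Σ_i h_{s_i}  (= n · h̃)
totalHeight : List BitString → ℕ
totalHeight S = sum (map (height (WT S)) S)

distinct : List BitString → List BitString
distinct = deduplicate _≟s_

occ : List BitString → BitString → ℕ
occ S c = length (filter (c ≟s_) S)

occProd : List BitString → ℕ
occProd S = product (map (λ c → occ S c ^ occ S c) (distinct S))

{-# OPTIONS --safe #-}

-- A leaf holding n copies of one string has height 0, and there
-- ∏_c n_c ^ n_c = n ^ n. At an internal node the strings split into n₀ + n₁ = n by their
-- branching bit: each gains one level of height and loses at least that bit of length,
-- and the multiplicities factor over the two children. The first bound thus reduces to
-- n ^ n ≤ 2 ^ n · n₀ ^ n₀ · n₁ ^ n₁, i.e. binary entropy is at most one, an instance of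
-- weighted AM–GM; in logarithms the bound reads n H₀(S) ≤ Σ_i h_{s_i}.

module Submission where

open import Defs
open import Data.Nat using (ℕ; _≤_; _*_; _^_)
open import Data.List using (List; []; length; map)
open import Data.Nat.ListAction using (sum)
open import Data.Product using (_×_)
open import Relation.Binary.PropositionalEquality using (_≢_)

open import Data.Bool using (true; false)
import Data.Bool.Properties as Bool
open import Data.List using (_∷_; _++_; drop; filter; foldl; replicate)
import Data.List.Properties as ListP
open import Data.List.Membership.Propositional using (_∈_)
open import Data.List.Membership.Propositional.Properties using (∈-filter⁻; ∈-map⁻)
open import Data.List.Relation.Unary.All using (All; []; _∷_; all?)
import Data.List.Relation.Unary.All as All
import Data.List.Relation.Unary.All.Properties as All
open import Data.List.Relation.Unary.Any using (here; there)
open import Data.Nat using (zero; suc; _+_; _<_; z≤n; s≤s; s≤s⁻¹; NonZero)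
open import Data.Nat.ListAction using (product)
open import Data.Nat.ListAction.Properties using (sum-++; product-++)
open import Data.Nat.Properties
open import Algebra.Properties.CommutativeSemigroup *-commutativeSemigroup using (interchange; x∙yz≈y∙xz)
open import Data.Nat.Tactic.RingSolver using (solve-∀)
open import Data.Product using (_,_; proj₁; proj₂)
import Data.Product as Product
open import Data.Sum using (inj₁; inj₂)
open import Function using (_∘_)
open import Relation.Nullary using (yes; no; ¬_; ¬?; contradiction)
open import Relation.Binary.PropositionalEquality
  using (_≡_; refl; sym; trans; cong; cong₂; subst; subst₂; module ≡-Reasoning)

^-distribʳ-* : ∀ m n o → (m * n) ^ o ≡ m ^ o * n ^ o
^-distribʳ-* m n zero    = refl
^-distribʳ-* m n (suc o) =
  trans (cong (m * n *_) (^-distribʳ-* m n o)) (interchange m n (m ^ o) (n ^ o))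

n^n≢0 : ∀ n → NonZero (n ^ n)
n^n≢0 zero    = _
n^n≢0 (suc n) = m^n≢0 (suc n) (suc n)

rearrangement : ∀ {x y u v} → x ≤ y → u ≤ v → x * v + y * u ≤ x * u + y * v
rearrangement {x} {u = u} x≤y u≤v with m≤n⇒∃[o]m+o≡n x≤y | m≤n⇒∃[o]m+o≡n u≤v
... | d , refl | e , refl = begin
  x * (u + e) + (x + d) * u          ≤⟨ m≤m+n _ (d * e) ⟩
  x * (u + e) + (x + d) * u + d * e  ≡⟨ expand x d u e ⟩
  x * u + (x + d) * (u + e)          ∎
  where
  open ≤-Reasoning
  expand : ∀ x d u e → x * (u + e) + (x + d) * u + d * e ≡ x * u + (x + d) * (u + e)
  expand = solve-∀

pow-rearrangement : ∀ P Q n → P * Q ^ n + Q * P ^ n ≤ P * P ^ n + Q * Q ^ n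
pow-rearrangement P Q n with ≤-total P Q
... | inj₁ P≤Q = rearrangement P≤Q (^-monoˡ-≤ n P≤Q)
... | inj₂ Q≤P = begin
  P * Q ^ n + Q * P ^ n  ≡⟨ +-comm (P * Q ^ n) _ ⟩
  Q * P ^ n + P * Q ^ n  ≤⟨ rearrangement Q≤P (^-monoˡ-≤ n Q≤P) ⟩
  Q * Q ^ n + P * P ^ n  ≡⟨ +-comm (Q * Q ^ n) _ ⟩
  P * P ^ n + Q * Q ^ n  ∎
  where open ≤-Reasoning

young : ∀ k P Q → suc k * P * Q ^ k ≤ P ^ suc k + k * Q ^ suc k
young zero    P Q = ≤-reflexive (base P)
  where
  base : ∀ P → 1 * P * 1 ≡ P * 1 + 0
  base = solve-∀
young (suc k) P Q = begin
  suc (suc k) * P * (Q * Q ^ k)                        ≡⟨ split k P Q (Q ^ k) ⟩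
  suc k * P * Q ^ k * Q + P * (Q * Q ^ k)              ≤⟨ +-monoˡ-≤ _ (*-monoˡ-≤ Q (young k P Q)) ⟩
  (P ^ suc k + k * Q ^ suc k) * Q + P * (Q * Q ^ k)    ≡⟨ regroup k P Q (P ^ suc k) (Q ^ k) ⟩
  k * Q ^ suc (suc k) + (P * Q ^ suc k + Q * P ^ suc k)
    ≤⟨ +-monoʳ-≤ (k * Q ^ suc (suc k)) (pow-rearrangement P Q (suc k)) ⟩
  k * Q ^ suc (suc k) + (P * P ^ suc k + Q * Q ^ suc k) ≡⟨ collect k P Q (P ^ suc k) (Q ^ k) ⟩
  P ^ suc (suc k) + suc k * Q ^ suc (suc k)            ∎
  where
  open ≤-Reasoning
  split : ∀ k P Q A → suc (suc k) * P * (Q * A) ≡ suc k * P * A * Q + P * (Q * A)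
  split = solve-∀
  regroup : ∀ k P Q X A → (X + k * (Q * A)) * Q + P * (Q * A) ≡ k * (Q * (Q * A)) + (P * (Q * A) + Q * X)
  regroup = solve-∀
  collect : ∀ k P Q X A → k * (Q * (Q * A)) + (P * X + Q * (Q * A)) ≡ P * X + suc k * (Q * (Q * A))
  collect = solve-∀

-- Young's inequality at P = n (y + S) and Q = (n + 1) S, which coincide exactly in the
-- equality case y = S / n.
am-gm-step : ∀ n S y → y * S ^ n * suc n ^ suc n ≤ n ^ n * (y + S) ^ suc n
am-gm-step zero S y = begin
  y * 1 * (1 * 1)  ≡⟨ trans (*-identityʳ (y * 1)) (*-identityʳ y) ⟩
  y                ≤⟨ m≤m+n y S ⟩
  y + S            ≡⟨ sym (trans (*-identityˡ _) (*-identityʳ (y + S))) ⟩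
  1 * ((y + S) * 1) ∎
  where open ≤-Reasoning
am-gm-step n@(suc _) S y = *-cancelˡ-≤ n (+-cancelʳ-≤ (n * Q ^ m) _ _ (begin
  n * (y * S ^ n * m ^ m) + n * Q ^ m
    ≡⟨ cong (λ z → n * (y * S ^ n * m ^ m) + n * z) (^-distribʳ-* m S m) ⟩
  n * (y * S ^ n * m ^ m) + n * (m ^ m * S ^ m)
    ≡⟨ expand n y S (m ^ n) (S ^ n) ⟩
  m * P * (m ^ n * S ^ n)
    ≡⟨ cong (m * P *_) (^-distribʳ-* m S n) ⟨
  m * P * Q ^ n
    ≤⟨ young n P Q ⟩
  P ^ m + n * Q ^ m
    ≡⟨ cong (_+ n * Q ^ m) (trans (^-distribʳ-* n (y + S) m) (*-assoc n (n ^ n) _)) ⟩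
  n * (n ^ n * (y + S) ^ m) + n * Q ^ m ∎))
  where
  open ≤-Reasoning
  m = suc n
  P = n * (y + S)
  Q = m * S
  expand : ∀ n y S A B →
    n * (y * B * (suc n * A)) + n * (suc n * A * (S * B)) ≡ suc n * (n * (y + S)) * (A * B)
  expand = solve-∀

am-gm : ∀ xs → length xs ^ length xs * product xs ≤ sum xs ^ length xs
am-gm []       = ≤-refl
am-gm (y ∷ xs) = *-cancelˡ-≤ (n ^ n) {{n^n≢0 n}} (begin
  n ^ n * (m ^ m * (y * product xs))  ≡⟨ regroup (n ^ n) (m ^ m) y (product xs) ⟩
  y * (n ^ n * product xs) * m ^ m    ≤⟨ *-monoˡ-≤ (m ^ m) (*-monoʳ-≤ y (am-gm xs)) ⟩
  y * sum xs ^ n * m ^ m              ≤⟨ am-gm-step n (sum xs) y ⟩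
  n ^ n * (y + sum xs) ^ m            ∎)
  where
  open ≤-Reasoning
  n = length xs
  m = suc n
  regroup : ∀ N M y p → N * (M * (y * p)) ≡ y * (N * p) * M
  regroup = solve-∀

sum-replicate : ∀ n x → sum (replicate n x) ≡ n * x
sum-replicate zero    x = refl
sum-replicate (suc n) x = cong (x +_) (sum-replicate n x)

product-replicate : ∀ n x → product (replicate n x) ≡ x ^ n
product-replicate zero    x = refl
product-replicate (suc n) x = cong (x *_) (product-replicate n x)

weighted-am-gm : ∀ a b x y → (a + b) ^ (a + b) * (x ^ a * y ^ b) ≤ (a * x + b * y) ^ (a + b)
weighted-am-gm a b x y = begin
  (a + b) ^ (a + b) * (x ^ a * y ^ b)  ≡⟨ cong₂ (λ n p → n ^ n * p) len prod ⟨
  length L ^ length L * product L      ≤⟨ am-gm L ⟩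
  sum L ^ length L                     ≡⟨ cong₂ _^_ sm len ⟩
  (a * x + b * y) ^ (a + b)            ∎
  where
  open ≤-Reasoning
  L = replicate a x ++ replicate b y
  len : length L ≡ a + b
  len = trans (ListP.length-++ (replicate a x))
              (cong₂ _+_ (ListP.length-replicate a) (ListP.length-replicate b))
  prod : product L ≡ x ^ a * y ^ b
  prod = trans (product-++ (replicate a x) _) (cong₂ _*_ (product-replicate a x) (product-replicate b y))
  sm : sum L ≡ a * x + b * y
  sm = trans (sum-++ (replicate a x) _) (cong₂ _+_ (sum-replicate a x) (sum-replicate b y))

binary-entropy-≤-1 : ∀ a b → (a + b) ^ (a + b) ≤ 2 ^ (a + b) * (a ^ a * b ^ b)
binary-entropy-≤-1 zero b =
  subst (λ z → b ^ b ≤ 2 ^ b * z) (sym (*-identityˡ (b ^ b))) (m≤n*m (b ^ b) (2 ^ b) {{m^n≢0 2 b}})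
binary-entropy-≤-1 a@(suc _) zero =
  subst (λ n → n ^ n ≤ 2 ^ n * (a ^ a * 1)) (sym (+-identityʳ a))
    (subst (λ z → a ^ a ≤ 2 ^ a * z) (sym (*-identityʳ (a ^ a))) (m≤n*m (a ^ a) (2 ^ a) {{m^n≢0 2 a}}))
binary-entropy-≤-1 a@(suc _) b@(suc _) =
  *-cancelˡ-≤ (b ^ a * a ^ b) {{m*n≢0 (b ^ a) (a ^ b) {{m^n≢0 b a}} {{m^n≢0 a b}}}} (begin
  b ^ a * a ^ b * n ^ n                       ≡⟨ *-comm (b ^ a * a ^ b) (n ^ n) ⟩
  n ^ n * (b ^ a * a ^ b)                     ≤⟨ weighted-am-gm a b b a ⟩
  (a * b + b * a) ^ n                         ≡⟨ cong (_^ n) (double a b) ⟩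
  (2 * (a * b)) ^ n
    ≡⟨ trans (^-distribʳ-* 2 (a * b) n) (cong (2 ^ n *_) (^-distribʳ-* a b n)) ⟩
  2 ^ n * (a ^ n * b ^ n)
    ≡⟨ cong₂ (λ u v → 2 ^ n * (u * v)) (^-distribˡ-+-* a a b) (^-distribˡ-+-* b a b) ⟩
  2 ^ n * (a ^ a * a ^ b * (b ^ a * b ^ b))   ≡⟨ regroup (2 ^ n) (a ^ a) (a ^ b) (b ^ a) (b ^ b) ⟩
  b ^ a * a ^ b * (2 ^ n * (a ^ a * b ^ b))   ∎)
  where
  open ≤-Reasoning
  n = a + b
  double : ∀ a b → a * b + b * a ≡ 2 * (a * b)
  double = solve-∀
  regroup : ∀ t p q r s → t * (p * q * (r * s)) ≡ r * q * (t * (p * s))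
  regroup = solve-∀

self-power-bound-+ : ∀ {n₀ n₁ h₀ h₁ p₀ p₁} →
  n₀ ^ n₀ ≤ 2 ^ h₀ * p₀ → n₁ ^ n₁ ≤ 2 ^ h₁ * p₁ →
  (n₀ + n₁) ^ (n₀ + n₁) ≤ 2 ^ ((n₀ + n₁) + (h₀ + h₁)) * (p₀ * p₁)
self-power-bound-+ {n₀} {n₁} {h₀} {h₁} {p₀} {p₁} b₀ b₁ = begin
  (n₀ + n₁) ^ (n₀ + n₁)                   ≤⟨ binary-entropy-≤-1 n₀ n₁ ⟩
  2 ^ n * (n₀ ^ n₀ * n₁ ^ n₁)             ≤⟨ *-monoʳ-≤ (2 ^ n) (*-mono-≤ b₀ b₁) ⟩
  2 ^ n * (2 ^ h₀ * p₀ * (2 ^ h₁ * p₁))   ≡⟨ cong (2 ^ n *_) (interchange (2 ^ h₀) p₀ (2 ^ h₁) p₁) ⟩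
  2 ^ n * (2 ^ h₀ * 2 ^ h₁ * (p₀ * p₁))   ≡⟨ *-assoc (2 ^ n) _ _ ⟨
  2 ^ n * (2 ^ h₀ * 2 ^ h₁) * (p₀ * p₁)   ≡⟨ cong (λ z → 2 ^ n * z * (p₀ * p₁)) (^-distribˡ-+-* 2 h₀ h₁) ⟨
  2 ^ n * 2 ^ (h₀ + h₁) * (p₀ * p₁)       ≡⟨ cong (_* (p₀ * p₁)) (^-distribˡ-+-* 2 n (h₀ + h₁)) ⟨
  2 ^ (n + (h₀ + h₁)) * (p₀ * p₁)         ∎
  where
  open ≤-Reasoning
  n = n₀ + n₁

without : BitString → List BitString → List BitString
without x = filter (¬? ∘ (x ≟s_))

occ-here : ∀ x xs → occ (x ∷ xs) x ≡ suc (occ xs x)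
occ-here x xs = cong length (ListP.filter-accept (x ≟s_) refl)

occ-there : ∀ {x y} xs → x ≢ y → occ (y ∷ xs) x ≡ occ xs x
occ-there xs x≢y = cong length (ListP.filter-reject (_ ≟s_) x≢y)

occ-without-self : ∀ x D → occ (without x D) x ≡ 0
occ-without-self x [] = refl
occ-without-self x (y ∷ D) with x ≟s y
... | yes refl = occ-without-self x D
... | no x≢y   = trans (occ-there (without x D) x≢y) (occ-without-self x D)

occ-without-other : ∀ {x y} D → x ≢ y → occ (without y D) x ≡ occ D x
occ-without-other [] _ = refl
occ-without-other {x} {y} (z ∷ D) x≢y with y ≟s z
... | yes refl = trans (occ-without-other D x≢y) (sym (occ-there D x≢y))
... | no _ with x ≟s z
...   | yes _ = cong suc (occ-without-other D x≢y)
...   | no _  = occ-without-other D x≢y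

-- x occurs once in distinct L if it occurs in L at all, and otherwise in neither.
pow-occ-distinct : ∀ g x L → (g ^ occ L x) ^ occ (distinct L) x ≡ g ^ occ L x
pow-occ-distinct g x [] = refl
pow-occ-distinct g x (y ∷ L) with x ≟s y
... | yes refl rewrite occ-without-self x (distinct L) = *-identityʳ _
... | no x≢y   rewrite occ-without-other (distinct L) x≢y = pow-occ-distinct g x L

product-pow-occ : ∀ (h : BitString → ℕ) x D →
  product (map h D) ≡ h x ^ occ D x * product (map h (without x D))
product-pow-occ h x [] = refl
product-pow-occ h x (y ∷ D) with x ≟s y
... | yes refl = trans (cong (h x *_) (product-pow-occ h x D)) (sym (*-assoc (h x) _ _))
... | no _     = trans (cong (h y *_) (product-pow-occ h x D)) (x∙yz≈y∙xz (h y) (h x ^ occ D x) _)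

product-distinct-pow-occ : ∀ (f : BitString → ℕ) L →
  product (map (λ c → f c ^ occ L c) (distinct L)) ≡ product (map f L)
product-distinct-pow-occ f [] = refl
product-distinct-pow-occ f (x ∷ xs) = begin
  f x ^ occ (x ∷ xs) x * product (map (λ c → f c ^ occ (x ∷ xs) c) (without x D))
    ≡⟨ cong₂ _*_ (cong (f x ^_) (occ-here x xs))
                 (cong product (ListP.map-cong-local (All.tabulate occ-unchanged))) ⟩
  f x ^ suc (occ xs x) * product (map h (without x D))
    ≡⟨ *-assoc (f x) _ _ ⟩
  f x * (f x ^ occ xs x * product (map h (without x D)))
    ≡⟨ cong (λ z → f x * (z * product (map h (without x D)))) (pow-occ-distinct (f x) x xs) ⟨
  f x * (h x ^ occ D x * product (map h (without x D)))
    ≡⟨ cong (f x *_) (product-pow-occ h x D) ⟨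
  f x * product (map h D)
    ≡⟨ cong (f x *_) (product-distinct-pow-occ f xs) ⟩
  f x * product (map f xs) ∎
  where
  open ≡-Reasoning
  D = distinct xs
  h : BitString → ℕ
  h c = f c ^ occ xs c
  occ-unchanged : ∀ {c} → c ∈ without x D → f c ^ occ (x ∷ xs) c ≡ h c
  occ-unchanged c∈ = cong (f _ ^_) (occ-there xs (proj₂ (∈-filter⁻ (¬? ∘ (x ≟s_)) {xs = D} c∈) ∘ sym))

[]-≼ : ∀ {v} → [] ≼ v
[]-≼ {v} = v , refl

≼-refl : ∀ {u} → u ≼ u
≼-refl {u} = [] , ListP.++-identityʳ u

≼-trans : ∀ {u v w} → u ≼ v → v ≼ w → u ≼ w
≼-trans {u} (a , refl) (b , refl) = a ++ b , sym (ListP.++-assoc u a b)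

∷-≼ : ∀ b {u v} → u ≼ v → (b ∷ u) ≼ (b ∷ v)
∷-≼ b (w , refl) = w , refl

++-≼ : ∀ α {u v} → u ≼ v → (α ++ u) ≼ (α ++ v)
++-≼ α {u} (w , refl) = w , ListP.++-assoc α u w

lcp₂-≼ : ∀ u v → lcp₂ u v ≼ u × lcp₂ u v ≼ v
lcp₂-≼ (true  ∷ u) (true  ∷ v) = Product.map (∷-≼ true) (∷-≼ true) (lcp₂-≼ u v)
lcp₂-≼ (false ∷ u) (false ∷ v) = Product.map (∷-≼ false) (∷-≼ false) (lcp₂-≼ u v)
lcp₂-≼ []          _           = []-≼ , []-≼
lcp₂-≼ (true  ∷ _) []          = []-≼ , []-≼
lcp₂-≼ (true  ∷ _) (false ∷ _) = []-≼ , []-≼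
lcp₂-≼ (false ∷ _) []          = []-≼ , []-≼
lcp₂-≼ (false ∷ _) (true  ∷ _) = []-≼ , []-≼

CommonPrefix : BitString → List BitString → Set
CommonPrefix α S = ∀ {s} → s ∈ S → α ≼ s

foldl-lcp₂-≼ : ∀ acc ys → CommonPrefix (foldl lcp₂ acc ys) (acc ∷ ys)
foldl-lcp₂-≼ acc []       (here refl)         = ≼-refl
foldl-lcp₂-≼ acc (y ∷ ys) (here refl)         =
  ≼-trans (foldl-lcp₂-≼ (lcp₂ acc y) ys (here refl)) (proj₁ (lcp₂-≼ acc y))
foldl-lcp₂-≼ acc (y ∷ ys) (there (here refl)) =
  ≼-trans (foldl-lcp₂-≼ (lcp₂ acc y) ys (here refl)) (proj₂ (lcp₂-≼ acc y))
foldl-lcp₂-≼ acc (y ∷ ys) (there (there s∈)) = foldl-lcp₂-≼ (lcp₂ acc y) ys (there s∈)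

lcp-≼ : ∀ S → CommonPrefix (lcp S) S
lcp-≼ (x ∷ xs) = foldl-lcp₂-≼ x xs

drop-length-++ : ∀ (α w : BitString) → drop (length α) (α ++ w) ≡ w
drop-length-++ []      w = refl
drop-length-++ (_ ∷ α) w = drop-length-++ α w

≼⇒≡++drop : ∀ {α s} → α ≼ s → s ≡ α ++ drop (length α) s
≼⇒≡++drop {α} (w , refl) = cong (α ++_) (sym (drop-length-++ α w))

drop-length-injective : ∀ {α s t} → α ≼ s → α ≼ t → drop (length α) s ≡ drop (length α) t → s ≡ t
drop-length-injective {α} α≼s α≼t e =
  trans (≼⇒≡++drop α≼s) (trans (cong (α ++_) e) (sym (≼⇒≡++drop α≼t)))

strip : BitString → List BitString → List BitString
strip α = map (drop (length α))

PrefixFree-strip : ∀ {α S} → CommonPrefix α S → PrefixFree S → PrefixFree (strip α S)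
PrefixFree-strip {α} pre pf u∈ v∈ u≼v
  with s , s∈ , refl ← ∈-map⁻ (drop (length α)) u∈
     | t , t∈ , refl ← ∈-map⁻ (drop (length α)) v∈
  = cong (drop (length α)) (pf s∈ t∈ s≼t)
  where
  s≼t : s ≼ t
  s≼t = subst₂ _≼_ (sym (≼⇒≡++drop (pre s∈))) (sym (≼⇒≡++drop (pre t∈))) (++-≼ α u≼v)

sub-∈ : ∀ b {u} R → u ∈ sub b R → (b ∷ u) ∈ R
sub-∈ b ([] ∷ R) u∈ = there (sub-∈ b R u∈)
sub-∈ b ((c ∷ γ) ∷ R) u∈ with b Bool.≟ c
sub-∈ b ((c ∷ γ) ∷ R) (here refl) | yes refl = here refl
sub-∈ b ((c ∷ γ) ∷ R) (there u∈)  | yes refl = there (sub-∈ b R u∈)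
... | no _ = there (sub-∈ b R u∈)

PrefixFree-sub : ∀ b {R} → PrefixFree R → PrefixFree (sub b R)
PrefixFree-sub b {R} pf u∈ v∈ u≼v = ListP.∷-injectiveʳ (pf (sub-∈ b R u∈) (sub-∈ b R v∈) (∷-≼ b u≼v))

occ-map : ∀ (f : BitString → BitString) {s} S → (∀ {t} → t ∈ S → f s ≡ f t → s ≡ t) →
  occ S s ≡ occ (map f S) (f s)
occ-map f []          _   = refl
occ-map f {s} (t ∷ S) inj with s ≟s t | f s ≟s f t
... | yes _   | yes _    = cong suc (occ-map f S (inj ∘ there))
... | no _    | no _     = occ-map f S (inj ∘ there)
... | yes s≡t | no fs≢ft = contradiction (cong f s≡t) fs≢ft
... | no s≢t  | yes fs≡ft = contradiction (inj (here refl) fs≡ft) s≢t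

NonEmpty : BitString → Set
NonEmpty s = s ≢ []

totalLength : List BitString → ℕ
totalLength S = sum (map length S)

multiplicityProduct : List BitString → ℕ
multiplicityProduct S = product (map (occ S) S)

heightSum : WTree → List BitString → ℕ
heightSum t S = sum (map (height t) S)

branch : (BitString → ℕ) → (BitString → ℕ) → BitString → ℕ
branch h₀ h₁ []          = 0
branch h₀ h₁ (false ∷ γ) = suc (h₀ γ)
branch h₀ h₁ (true  ∷ γ) = suc (h₁ γ)

length-sub : ∀ R → All NonEmpty R → length R ≡ length (sub false R) + length (sub true R)
length-sub []                []       = refl
length-sub ([] ∷ R)          (ne ∷ _) = contradiction refl ne
length-sub ((false ∷ _) ∷ R) (_ ∷ ne) = cong suc (length-sub R ne)
length-sub ((true  ∷ _) ∷ R) (_ ∷ ne) = trans (cong suc (length-sub R ne)) (sym (+-suc _ _))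

sum-branch : ∀ h₀ h₁ R → All NonEmpty R →
  sum (map (branch h₀ h₁) R) ≡ length R + (sum (map h₀ (sub false R)) + sum (map h₁ (sub true R)))
sum-branch h₀ h₁ []                []       = refl
sum-branch h₀ h₁ ([] ∷ R)          (ne ∷ _) = contradiction refl ne
sum-branch h₀ h₁ ((false ∷ γ) ∷ R) (_ ∷ ne) =
  cong suc (trans (cong (h₀ γ +_) (sum-branch h₀ h₁ R ne))
                  (shuffle (h₀ γ) (length R) (sum (map h₀ (sub false R))) _))
  where
  shuffle : ∀ a n p q → a + (n + (p + q)) ≡ n + (a + p + q)
  shuffle = solve-∀
sum-branch h₀ h₁ ((true  ∷ γ) ∷ R) (_ ∷ ne) =
  cong suc (trans (cong (h₁ γ +_) (sum-branch h₀ h₁ R ne))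
                  (shuffle (h₁ γ) (length R) (sum (map h₀ (sub false R))) _))
  where
  shuffle : ∀ a n p q → a + (n + (p + q)) ≡ n + (p + (a + q))
  shuffle = solve-∀

length≗branch : ∀ s → length s ≡ branch length length s
length≗branch []          = refl
length≗branch (false ∷ _) = refl
length≗branch (true  ∷ _) = refl

totalLength-sub : ∀ R → All NonEmpty R →
  totalLength R ≡ length R + (totalLength (sub false R) + totalLength (sub true R))
totalLength-sub R ne = trans (cong sum (ListP.map-cong length≗branch R)) (sum-branch length length R ne)

product-sub : ∀ (g : BitString → ℕ) R → All NonEmpty R →
  product (map g R) ≡
    product (map (g ∘ (false ∷_)) (sub false R)) * product (map (g ∘ (true ∷_)) (sub true R))
product-sub g []                []       = refl
product-sub g ([] ∷ R)          (ne ∷ _) = contradiction refl ne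
product-sub g ((false ∷ γ) ∷ R) (_ ∷ ne) =
  trans (cong (g (false ∷ γ) *_) (product-sub g R ne)) (sym (*-assoc (g (false ∷ γ)) _ _))
product-sub g ((true  ∷ γ) ∷ R) (_ ∷ ne) =
  trans (cong (g (true ∷ γ) *_) (product-sub g R ne))
        (x∙yz≈y∙xz (g (true ∷ γ)) (product (map (g ∘ (false ∷_)) (sub false R))) _)

occ-∷-sub : ∀ b R γ → occ R (b ∷ γ) ≡ occ (sub b R) γ
occ-∷-sub b []            γ = refl
occ-∷-sub b ([] ∷ R)      γ = occ-∷-sub b R γ
occ-∷-sub b ((c ∷ δ) ∷ R) γ with b Bool.≟ c
... | no _ = occ-∷-sub b R γ
... | yes refl with γ ≟s δ
...   | yes refl = cong suc (occ-∷-sub b R γ)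
...   | no _     = occ-∷-sub b R γ

multiplicityProduct-sub : ∀ R → All NonEmpty R →
  multiplicityProduct R ≡ multiplicityProduct (sub false R) * multiplicityProduct (sub true R)
multiplicityProduct-sub R ne = trans (product-sub (occ R) R ne)
  (cong₂ _*_ (cong product (ListP.map-cong (occ-∷-sub false R) (sub false R)))
             (cong product (ListP.map-cong (occ-∷-sub true R) (sub true R))))

multiplicityProduct-strip : ∀ {α S} → CommonPrefix α S →
  multiplicityProduct S ≡ multiplicityProduct (strip α S)
multiplicityProduct-strip {α} {S} pre = trans
  (cong product (ListP.map-cong-local (All.tabulate λ s∈ →
    occ-map (drop (length α)) S λ t∈ → drop-length-injective (pre s∈) (pre t∈))))
  (cong product (ListP.map-∘ S))

totalLength-strip-≤ : ∀ α S → totalLength (strip α S) ≤ totalLength S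
totalLength-strip-≤ α []      = z≤n
totalLength-strip-≤ α (s ∷ S) = +-mono-≤ length-drop-≤ (totalLength-strip-≤ α S)
  where
  length-drop-≤ : length (drop (length α) s) ≤ length s
  length-drop-≤ =
    subst (_≤ length s) (sym (ListP.length-drop (length α) s)) (m∸n≤m (length s) (length α))

height-node : ∀ α β t₀ t₁ s →
  height (node α β t₀ t₁) s ≡ branch (height t₀) (height t₁) (drop (length α) s)
height-node α β t₀ t₁ s with drop (length α) s
... | []        = refl
... | false ∷ _ = refl
... | true  ∷ _ = refl

heightSum-node : ∀ α β t₀ t₁ S → All NonEmpty (strip α S) →
  heightSum (node α β t₀ t₁) S ≡
    length S + (heightSum t₀ (sub false (strip α S)) + heightSum t₁ (sub true (strip α S)))
heightSum-node α β t₀ t₁ S ne = begin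
  sum (map (height (node α β t₀ t₁)) S)
    ≡⟨ cong sum (ListP.map-cong (height-node α β t₀ t₁) S) ⟩
  sum (map (branch (height t₀) (height t₁) ∘ drop (length α)) S)
    ≡⟨ cong sum (ListP.map-∘ S) ⟩
  sum (map (branch (height t₀) (height t₁)) (strip α S))
    ≡⟨ sum-branch (height t₀) (height t₁) (strip α S) ne ⟩
  length (strip α S) + H
    ≡⟨ cong (_+ H) (ListP.length-map _ S) ⟩
  length S + H
    ∎
  where
  open ≡-Reasoning
  H = heightSum t₀ (sub false (strip α S)) + heightSum t₁ (sub true (strip α S))

heightSum-leaf : ∀ x S → heightSum (leaf x) S ≡ 0
heightSum-leaf x []      = refl
heightSum-leaf x (_ ∷ S) = heightSum-leaf x S

occ-all : ∀ {x} L → All (_≡ x) L → occ L x ≡ length L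
occ-all []           []           = refl
occ-all {x} (.x ∷ L) (refl ∷ all) = trans (occ-here x L) (cong suc (occ-all L all))

product-const : ∀ {c} (g : BitString → ℕ) L → All (λ s → g s ≡ c) L → product (map g L) ≡ c ^ length L
product-const g []      []           = refl
product-const {c} g (_ ∷ L) (refl ∷ all) = cong (c *_) (product-const g L all)

HeightBounds : WTree → List BitString → Set
HeightBounds t S =
  (length S ^ length S ≤ 2 ^ heightSum t S * multiplicityProduct S) × (heightSum t S ≤ totalLength S)

leaf-bounds : ∀ {x xs} → All (_≡ x) xs → HeightBounds (leaf x) (x ∷ xs)
leaf-bounds {x} {xs} all = ≤-reflexive entropy , subst (_≤ totalLength S) (sym (heightSum-leaf x S)) z≤n
  where
  open ≡-Reasoning
  S = x ∷ xs
  occ≡n : All (λ s → occ S s ≡ length S) S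
  occ≡n = All.map (λ { refl → occ-all S (refl ∷ all) }) (refl ∷ all)
  entropy : length S ^ length S ≡ 2 ^ heightSum (leaf x) S * multiplicityProduct S
  entropy = begin
    length S ^ length S
      ≡⟨ product-const (occ S) S occ≡n ⟨
    multiplicityProduct S
      ≡⟨ *-identityˡ _ ⟨
    1 * multiplicityProduct S
      ≡⟨ cong (λ h → 2 ^ h * multiplicityProduct S) (heightSum-leaf x S) ⟨
    2 ^ heightSum (leaf x) S * multiplicityProduct S
      ∎

node-bounds : ∀ {α S t₀ t₁} β → CommonPrefix α S → All NonEmpty (strip α S) →
  HeightBounds t₀ (sub false (strip α S)) → HeightBounds t₁ (sub true (strip α S)) →
  HeightBounds (node α β t₀ t₁) S
node-bounds {α} {S} {t₀} {t₁} β pre ne (entropy₀ , length₀) (entropy₁ , length₁) = entropy , length-bound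
  where
  R = strip α S
  R₀ = sub false R
  R₁ = sub true R
  n≡ : length S ≡ length R₀ + length R₁
  n≡ = trans (sym (ListP.length-map _ S)) (length-sub R ne)
  h≡ : heightSum (node α β t₀ t₁) S ≡ (length R₀ + length R₁) + (heightSum t₀ R₀ + heightSum t₁ R₁)
  h≡ = trans (heightSum-node α β t₀ t₁ S ne) (cong (_+ (heightSum t₀ R₀ + heightSum t₁ R₁)) n≡)
  p≡ : multiplicityProduct S ≡ multiplicityProduct R₀ * multiplicityProduct R₁
  p≡ = trans (multiplicityProduct-strip pre) (multiplicityProduct-sub R ne)
  entropy : length S ^ length S ≤ 2 ^ heightSum (node α β t₀ t₁) S * multiplicityProduct S
  entropy = subst₂ _≤_ (cong (λ n → n ^ n) (sym n≡)) (cong₂ (λ h p → 2 ^ h * p) (sym h≡) (sym p≡))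
    (self-power-bound-+ {length R₀} {length R₁} {heightSum t₀ R₀} {heightSum t₁ R₁} entropy₀ entropy₁)
  length-bound : heightSum (node α β t₀ t₁) S ≤ totalLength S
  length-bound = begin
    heightSum (node α β t₀ t₁) S                  ≡⟨ heightSum-node α β t₀ t₁ S ne ⟩
    length S + (heightSum t₀ R₀ + heightSum t₁ R₁) ≤⟨ +-monoʳ-≤ (length S) (+-mono-≤ length₀ length₁) ⟩
    length S + L                                  ≡⟨ cong (_+ L) (ListP.length-map _ S) ⟨
    length R + L                                  ≡⟨ totalLength-sub R ne ⟨
    totalLength R                                 ≤⟨ totalLength-strip-≤ α S ⟩
    totalLength S                                 ∎
    where
    open ≤-Reasoning
    L = totalLength R₀ + totalLength R₁

strip-lcp-nonEmpty : ∀ {x xs} → PrefixFree (x ∷ xs) → ¬ All (_≡ x) xs →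
  All NonEmpty (strip (lcp (x ∷ xs)) (x ∷ xs))
strip-lcp-nonEmpty {x} {xs} pf ¬all = All.map⁺ (All.tabulate nonEmpty)
  where
  α = lcp (x ∷ xs)
  nonEmpty : ∀ {s} → s ∈ x ∷ xs → drop (length α) s ≢ []
  nonEmpty {s} s∈ rest≡[] = ¬all (All.tabulate λ t∈ → trans (sym (s≡ (there t∈))) (s≡ (here refl)))
    where
    s≡α : s ≡ α
    s≡α = trans (≼⇒≡++drop (lcp-≼ _ s∈)) (trans (cong (α ++_) rest≡[]) (ListP.++-identityʳ α))
    s≡ : ∀ {t} → t ∈ x ∷ xs → s ≡ t
    s≡ t∈ = pf s∈ t∈ (subst (_≼ _) (sym s≡α) (lcp-≼ _ t∈))

children-totalLength-< : ∀ r R → All NonEmpty (r ∷ R) →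
  totalLength (sub false (r ∷ R)) + totalLength (sub true (r ∷ R)) < totalLength (r ∷ R)
children-totalLength-< r R ne =
  subst (L <_) (sym (totalLength-sub (r ∷ R) ne)) (m<n+m L {suc (length R)} (s≤s z≤n))
  where L = totalLength (sub false (r ∷ R)) + totalLength (sub true (r ∷ R))

wtF-bounds : ∀ k S → totalLength S < k → PrefixFree S → HeightBounds (wtF k S) S
wtF-bounds _       []       _    _  = s≤s z≤n , z≤n
wtF-bounds (suc k) (x ∷ xs) fuel pf with all? (λ s → s ≟s x) xs
... | yes all≡x = leaf-bounds all≡x
... | no ¬all≡x =
  node-bounds (bits (strip α S)) (lcp-≼ S) ne
    (wtF-bounds k R₀ (≤-<-trans (m≤m+n _ _) children<k) (PrefixFree-sub false pfR))
    (wtF-bounds k R₁ (≤-<-trans (m≤n+m _ _) children<k) (PrefixFree-sub true pfR))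
  where
  S = x ∷ xs
  α = lcp S
  R₀ = sub false (strip α S)
  R₁ = sub true (strip α S)
  ne : All NonEmpty (strip α S)
  ne = strip-lcp-nonEmpty pf ¬all≡x
  pfR : PrefixFree (strip α S)
  pfR = PrefixFree-strip (lcp-≼ S) pf
  children<k : totalLength R₀ + totalLength R₁ < k
  children<k =
    <-≤-trans (children-totalLength-< _ _ ne) (≤-trans (totalLength-strip-≤ α S) (s≤s⁻¹ fuel))

lemma3 : (S : List BitString) → S ≢ [] → PrefixFree S →
    (length S ^ length S ≤ 2 ^ totalHeight S * occProd S)
      × (totalHeight S ≤ sum (map length S))
-- The bound holds for the empty sequence as well.
lemma3 S _ pf =
  Product.map₁ (subst (λ p → length S ^ length S ≤ 2 ^ totalHeight S * p) multiplicityProduct≡occProd)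
    (wtF-bounds (suc (totalLength S)) S ≤-refl pf)
  where
  multiplicityProduct≡occProd : multiplicityProduct S ≡ occProd S
  multiplicityProduct≡occProd = sym (product-distinct-pow-occ (occ S) S)
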